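{- Let $C$ be a code in $K(n,k)$ and suppose that $\mathrm{Aut}(C)$ acts transitively on $\Omega$. Then for every pair $u,v\in\Omega$ there exists a codeword $\beta\in C$ such that $u,v\in\Omega\setminus\beta$.
   Context: Let $\Omega$ be a finite set with $|\Omega|=n$ and $2\leq k\leq (n-1)/2$. The Kneser graph $K(n,k)$ has as vertices the $k$-subsets of $\Omega$, adjacent iff disjoint; its automorphism group is $\mathrm{Sym}(\Omega)$. A code $C$ is a set of vertices with $|C|\geq 2$, and $\mathrm{Aut}(C)$ is the setwise stabiliser of $C$ in $\mathrm{Sym}(\Omega)$. -}

module Defs where

open import Data.Nat using (ℕ; _≤_; _+_; _*_)
open import Data.Bool using (Bool; true; false)
open import Data.Fin using (Fin)
open import Data.Fin.Subset using (Subset; _∈_; _∉_; ∣_∣)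
open import Data.Fin.Permutation using (Permutation′; _⟨$⟩ʳ_; _⟨$⟩ˡ_)
open import Data.Vec using (tabulate; lookup)
open import Data.Product using (Σ; _×_; _,_)
open import Relation.Binary.PropositionalEquality using (_≡_; _≢_)

-- Ω = Fin n.  A subset of Ω is a 'Subset n' (Vec Bool n).
-- A set of vertices of K(n,k) (a family of subsets of Ω) is given by its
-- characteristic function  Subset n → Bool.
Family : ℕ → Set
Family n = Subset n → Bool

_∈C_ : ∀ {n} → Subset n → Family n → Set
β ∈C C = C β ≡ true

IsCode : (n k : ℕ) → Family n → Set
IsCode n k C =
  ((β : Subset n) → β ∈C C → ∣ β ∣ ≡ k)
  × Σ (Subset n) (λ β → Σ (Subset n) (λ γ → β ∈C C × γ ∈C C × β ≢ γ))

-- image σ(β) = { σ x | x ∈ β }, i.e. i ∈ σ(β) iff σ⁻¹(i) ∈ β.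
image : ∀ {n} → Permutation′ n → Subset n → Subset n
image σ β = tabulate (λ i → lookup β (σ ⟨$⟩ˡ i))

InAut : ∀ {n} → Family n → Permutation′ n → Set
InAut {n} C σ = (β : Subset n) → (β ∈C C → image σ β ∈C C) × (image σ β ∈C C → β ∈C C)

AutTransitive : ∀ {n} → Family n → Set
AutTransitive {n} C = (a b : Fin n) → Σ (Permutation′ n) (λ σ → InAut C σ × σ ⟨$⟩ʳ a ≡ b)

-- Double counting.  Let r x be the number of codewords containing the
-- point x.  Summing r over Ω counts every codeword k times, so
-- Σₓ r x = |C| k.  Aut(C) preserves r and is transitive, so r is a
-- constant r and n r = |C| k.  If every codeword met {u, v} we would
-- have |C| ≤ r u + r v = 2 r, hence n r ≤ 2 k r; as C is nonempty,
-- r > 0 and n ≤ 2 k, contradicting n ≥ 2 k + 1.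
module Submission where

open import Defs
open import Data.Nat using (ℕ; _≤_; _+_; _*_)
open import Data.Fin using (Fin)
open import Data.Fin.Subset using (Subset; _∉_)
open import Data.Product using (Σ; _×_)

open import Data.Bool using (Bool; true; false)
import Data.Bool.Properties as Boolₚ
open import Data.Empty using (⊥-elim)
open import Data.Fin using (zero; suc; combine; finToFun; funToFin)
open import Data.Fin.Permutation as Perm using (Permutation′; _⟨$⟩ʳ_; _⟨$⟩ˡ_; permutation)
open import Data.Fin.Properties using (2↔Bool; finToFun-funToFin; funToFin-finToFin)
open import Data.Fin.Subset using (_∈_; ∣_∣)
open import Data.Fin.Subset.Properties using (_∈?_; anySubset?)
open import Data.Nat using (zero; suc; z≤n; s≤s; _^_)
open import Data.Nat.Properties
open import Data.Product using (_,_; proj₁; proj₂)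
open import Data.Sum using (_⊎_; inj₁; inj₂)
open import Data.Vec using ([]; _∷_; tabulate; lookup)
open import Data.Vec.Properties using (lookup∘tabulate; tabulate∘lookup; tabulate-cong; []=⇒lookup)
open import Function using (_∘_; Inverse)
open import Relation.Binary.PropositionalEquality
open import Relation.Nullary using (yes; no; contradiction)
open import Relation.Nullary.Decidable using (_×-dec_; ¬?)
open import Algebra.Properties.Semiring.Sum +-*-semiring
  using (sum; sum-cong-≗; ∑-comm; sum-permute; *-distribˡ-sum; *-distribʳ-sum; ∑-distrib-+)

open Inverse 2↔Bool using ()
  renaming (to to toBool; from to fromBool; strictlyInverseˡ to toBool-fromBool; strictlyInverseʳ to fromBool-toBool)

sum-const : ∀ n a → sum {n} (λ _ → a) ≡ n * a
sum-const zero    a = refl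
sum-const (suc n) a = cong (a +_) (sum-const n a)

sum-mono : ∀ {n} {f g : Fin n → ℕ} → (∀ i → f i ≤ g i) → sum f ≤ sum g
sum-mono {zero}  f≤g = z≤n
sum-mono {suc n} f≤g = +-mono-≤ (f≤g zero) (sum-mono (f≤g ∘ suc))

term≤sum : ∀ {n} (f : Fin n → ℕ) i → f i ≤ sum f
term≤sum f zero    = m≤m+n _ _
term≤sum f (suc i) = ≤-trans (term≤sum (f ∘ suc) i) (m≤n+m _ _)

funToFin-cong : ∀ {m n} {f g : Fin m → Fin n} → f ≗ g → funToFin f ≡ funToFin g
funToFin-cong {zero}  f≗g = refl
funToFin-cong {suc m} f≗g = cong₂ combine (f≗g zero) (funToFin-cong (f≗g ∘ suc))

-- Subsets of Fin n are enumerated by Fin (2 ^ n), reading a characteristic vector as a base-2 numeral.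
toSubset : ∀ {n} → Fin (2 ^ n) → Subset n
toSubset {n} i = tabulate (toBool ∘ finToFun {2} {n} i)

fromSubset : ∀ {n} → Subset n → Fin (2 ^ n)
fromSubset β = funToFin (fromBool ∘ lookup β)

toSubset-fromSubset : ∀ {n} (β : Subset n) → toSubset (fromSubset β) ≡ β
toSubset-fromSubset β = begin
  tabulate (toBool ∘ finToFun (fromSubset β))  ≡⟨ tabulate-cong (λ j → cong toBool (finToFun-funToFin (fromBool ∘ lookup β) j)) ⟩
  tabulate (toBool ∘ fromBool ∘ lookup β)      ≡⟨ tabulate-cong (toBool-fromBool ∘ lookup β) ⟩
  tabulate (lookup β)                          ≡⟨ tabulate∘lookup β ⟩
  β                                            ∎
  where open ≡-Reasoning

fromSubset-toSubset : ∀ {n} (i : Fin (2 ^ n)) → fromSubset (toSubset {n} i) ≡ i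
fromSubset-toSubset {n} i = begin
  funToFin (fromBool ∘ lookup (toSubset {n} i))      ≡⟨ funToFin-cong (λ j → cong fromBool (lookup∘tabulate (toBool ∘ finToFun {2} {n} i) j)) ⟩
  funToFin (fromBool ∘ toBool ∘ finToFun {2} {n} i)  ≡⟨ funToFin-cong (fromBool-toBool ∘ finToFun {2} {n} i) ⟩
  funToFin (finToFun {2} {n} i)                      ≡⟨ funToFin-finToFin {n} {2} i ⟩
  i                                                  ∎
  where open ≡-Reasoning

∑ₛ : ∀ {n} → (Subset n → ℕ) → ℕ
∑ₛ {n} f = sum (f ∘ toSubset {n})

∑ₛ-reindex : ∀ {n} (f : Subset n → ℕ) {g h : Subset n → Subset n} →
             (∀ β → g (h β) ≡ β) → (∀ β → h (g β) ≡ β) → ∑ₛ (f ∘ g) ≡ ∑ₛ f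
∑ₛ-reindex {n} f {g} {h} g∘h≗id h∘g≗id = begin
  sum (f ∘ g ∘ toSubset)               ≡⟨ sum-permute (f ∘ g ∘ toSubset) π ⟩
  sum (f ∘ g ∘ toSubset ∘ (π ⟨$⟩ʳ_))   ≡⟨ sum-cong-≗ (λ i → cong (f ∘ g) (toSubset-fromSubset (h (toSubset {n} i)))) ⟩
  sum (f ∘ g ∘ h ∘ toSubset)           ≡⟨ sum-cong-≗ (λ i → cong f (g∘h≗id (toSubset {n} i))) ⟩
  sum (f ∘ toSubset)                   ∎
  where
  open ≡-Reasoning
  conj : (Subset n → Subset n) → Fin (2 ^ n) → Fin (2 ^ n)
  conj φ = fromSubset ∘ φ ∘ toSubset
  conj-inverse : ∀ {φ ψ} → (∀ β → φ (ψ β) ≡ β) → ∀ i → conj φ (conj ψ i) ≡ i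
  conj-inverse {φ} {ψ} φ∘ψ≗id i = begin
    fromSubset (φ (toSubset (fromSubset (ψ (toSubset {n} i)))))  ≡⟨ cong (fromSubset ∘ φ) (toSubset-fromSubset _) ⟩
    fromSubset (φ (ψ (toSubset {n} i)))                          ≡⟨ cong fromSubset (φ∘ψ≗id _) ⟩
    fromSubset (toSubset {n} i)                                  ≡⟨ fromSubset-toSubset {n} i ⟩
    i                                                            ∎
  π : Permutation′ (2 ^ n)
  π = permutation (conj h) (conj g) (conj-inverse {h} {g} h∘g≗id) (conj-inverse {g} {h} g∘h≗id)

∑ₛ-cong : ∀ {n} {f g : Subset n → ℕ} → (∀ β → f β ≡ g β) → ∑ₛ f ≡ ∑ₛ g
∑ₛ-cong f≗g = sum-cong-≗ (f≗g ∘ toSubset)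

∑ₛ-mono : ∀ {n} {f g : Subset n → ℕ} → (∀ β → f β ≤ g β) → ∑ₛ f ≤ ∑ₛ g
∑ₛ-mono f≤g = sum-mono (f≤g ∘ toSubset)

∑ₛ-distrib-+ : ∀ {n} (f g : Subset n → ℕ) → ∑ₛ (λ β → f β + g β) ≡ ∑ₛ f + ∑ₛ g
∑ₛ-distrib-+ f g = ∑-distrib-+ (f ∘ toSubset) (g ∘ toSubset)

*-distribʳ-∑ₛ : ∀ {n} k (f : Subset n → ℕ) → ∑ₛ f * k ≡ ∑ₛ (λ β → f β * k)
*-distribʳ-∑ₛ k f = *-distribʳ-sum k (f ∘ toSubset)

∑-∑ₛ-comm : ∀ {m n} (f : Fin m → Subset n → ℕ) → sum (λ x → ∑ₛ (f x)) ≡ ∑ₛ (λ β → sum (λ x → f x β))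
∑-∑ₛ-comm {m} {n} f = ∑-comm {m} {2 ^ n} (λ x i → f x (toSubset {n} i))

term≤∑ₛ : ∀ {n} (f : Subset n → ℕ) β → f β ≤ ∑ₛ f
term≤∑ₛ f β = subst (_≤ ∑ₛ f) (cong f (toSubset-fromSubset β)) (term≤sum (f ∘ toSubset) (fromSubset β))

image-flip : ∀ {n} (σ : Permutation′ n) β → image σ (image (Perm.flip σ) β) ≡ β
image-flip σ β = begin
  tabulate (λ i → lookup (image (Perm.flip σ) β) (σ ⟨$⟩ˡ i))  ≡⟨ tabulate-cong (λ i → lookup∘tabulate _ (σ ⟨$⟩ˡ i)) ⟩
  tabulate (λ i → lookup β (σ ⟨$⟩ʳ (σ ⟨$⟩ˡ i)))               ≡⟨ tabulate-cong (λ i → cong (lookup β) (Perm.inverseʳ σ)) ⟩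
  tabulate (lookup β)                                         ≡⟨ tabulate∘lookup β ⟩
  β                                                           ∎
  where open ≡-Reasoning

lookup-image : ∀ {n} (σ : Permutation′ n) β x → lookup (image σ β) (σ ⟨$⟩ʳ x) ≡ lookup β x
lookup-image σ β x = trans (lookup∘tabulate _ (σ ⟨$⟩ʳ x)) (cong (lookup β) (Perm.inverseˡ σ))

∑ₛ-image : ∀ {n} (f : Subset n → ℕ) (σ : Permutation′ n) → ∑ₛ (f ∘ image σ) ≡ ∑ₛ f
∑ₛ-image f σ = ∑ₛ-reindex f {image σ} {image (Perm.flip σ)} (image-flip σ) (image-flip (Perm.flip σ))

toℕ : Bool → ℕ
toℕ false = 0
toℕ true  = 1

sum-toℕ-lookup : ∀ {n} (β : Subset n) → sum (toℕ ∘ lookup β) ≡ ∣ β ∣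
sum-toℕ-lookup []          = refl
sum-toℕ-lookup (true  ∷ β) = cong suc (sum-toℕ-lookup β)
sum-toℕ-lookup (false ∷ β) = sum-toℕ-lookup β

⇔⇒≡ : ∀ {a b} → (a ≡ true → b ≡ true) → (b ≡ true → a ≡ true) → a ≡ b
⇔⇒≡ {true}  a⇒b b⇒a = sym (a⇒b refl)
⇔⇒≡ {false} {true}  a⇒b b⇒a = b⇒a refl
⇔⇒≡ {false} {false} a⇒b b⇒a = refl

module _ {n : ℕ} (C : Family n) where

  cardinality : ℕ
  cardinality = ∑ₛ (toℕ ∘ C)

  degree : Fin n → ℕ
  degree x = ∑ₛ (λ β → toℕ (C β) * toℕ (lookup β x))

  cardinality-pos : ∀ {β} → β ∈C C → 1 ≤ cardinality
  cardinality-pos {β} β∈C = subst (λ b → toℕ b ≤ cardinality) β∈C (term≤∑ₛ (toℕ ∘ C) β)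

  sum-degree : ∀ {k} → (∀ β → β ∈C C → ∣ β ∣ ≡ k) → sum degree ≡ cardinality * k
  sum-degree {k} uniform = begin
    sum (λ x → ∑ₛ (λ β → toℕ (C β) * toℕ (lookup β x)))  ≡⟨ ∑-∑ₛ-comm (λ x β → toℕ (C β) * toℕ (lookup β x)) ⟩
    ∑ₛ (λ β → sum (λ x → toℕ (C β) * toℕ (lookup β x)))  ≡⟨ ∑ₛ-cong (λ β → sym (*-distribˡ-sum (toℕ (C β)) (toℕ ∘ lookup β))) ⟩
    ∑ₛ (λ β → toℕ (C β) * sum (toℕ ∘ lookup β))          ≡⟨ ∑ₛ-cong (λ β → cong (toℕ (C β) *_) (sum-toℕ-lookup β)) ⟩
    ∑ₛ (λ β → toℕ (C β) * ∣ β ∣)                         ≡⟨ ∑ₛ-cong member-size ⟩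
    ∑ₛ (λ β → toℕ (C β) * k)                             ≡⟨ *-distribʳ-∑ₛ k (toℕ ∘ C) ⟨
    cardinality * k                                      ∎
    where
    open ≡-Reasoning
    member-size : ∀ β → toℕ (C β) * ∣ β ∣ ≡ toℕ (C β) * k
    member-size β with C β in β∈C
    ... | true  = cong (_+ 0) (uniform β β∈C)
    ... | false = refl

  C∘image≗C : ∀ σ → InAut C σ → ∀ β → C (image σ β) ≡ C β
  C∘image≗C σ σ∈Aut β = ⇔⇒≡ (proj₂ (σ∈Aut β)) (proj₁ (σ∈Aut β))

  degree-image : ∀ σ → InAut C σ → ∀ x → degree (σ ⟨$⟩ʳ x) ≡ degree x
  degree-image σ σ∈Aut x = begin
    ∑ₛ (λ β → toℕ (C β) * toℕ (lookup β (σ ⟨$⟩ʳ x)))                      ≡⟨ ∑ₛ-image (λ β → toℕ (C β) * toℕ (lookup β (σ ⟨$⟩ʳ x))) σ ⟨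
    ∑ₛ (λ β → toℕ (C (image σ β)) * toℕ (lookup (image σ β) (σ ⟨$⟩ʳ x)))  ≡⟨ ∑ₛ-cong (λ β → cong₂ (λ b c → toℕ b * toℕ c) (C∘image≗C σ σ∈Aut β) (lookup-image σ β x)) ⟩
    ∑ₛ (λ β → toℕ (C β) * toℕ (lookup β x))                                ∎
    where open ≡-Reasoning

  degree-constant : AutTransitive C → ∀ x y → degree x ≡ degree y
  degree-constant transitive x y with transitive y x
  ... | σ , σ∈Aut , σy≡x = trans (cong degree (sym σy≡x)) (degree-image σ σ∈Aut y)

  n*degree≡cardinality*k : ∀ {k} → (∀ β → β ∈C C → ∣ β ∣ ≡ k) → AutTransitive C →
                           ∀ u → n * degree u ≡ cardinality * k
  n*degree≡cardinality*k {k} uniform transitive u = begin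
    n * degree u             ≡⟨ sum-const n (degree u) ⟨
    sum {n} (λ _ → degree u) ≡⟨ sum-cong-≗ (λ x → degree-constant transitive x u) ⟨
    sum degree               ≡⟨ sum-degree uniform ⟩
    cardinality * k          ∎
    where open ≡-Reasoning

  cardinality≤degree+degree : ∀ {u v} → (∀ β → β ∈C C → u ∈ β ⊎ v ∈ β) →
                              cardinality ≤ degree u + degree v
  cardinality≤degree+degree {u} {v} meets = begin
    ∑ₛ (toℕ ∘ C)                                                          ≤⟨ ∑ₛ-mono member-counted ⟩
    ∑ₛ (λ β → toℕ (C β) * toℕ (lookup β u) + toℕ (C β) * toℕ (lookup β v))  ≡⟨ ∑ₛ-distrib-+ (λ β → toℕ (C β) * toℕ (lookup β u)) (λ β → toℕ (C β) * toℕ (lookup β v)) ⟩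
    degree u + degree v                                                   ∎
    where
    open ≤-Reasoning
    member-counted : ∀ β → toℕ (C β) ≤ toℕ (C β) * toℕ (lookup β u) + toℕ (C β) * toℕ (lookup β v)
    member-counted β with C β in β∈C
    ... | false = z≤n
    ... | true with meets β β∈C
    ...   | inj₁ u∈β rewrite []=⇒lookup u∈β = s≤s z≤n
    ...   | inj₂ v∈β rewrite []=⇒lookup v∈β = m≤n+m 1 _

avoiding-or-meeting : ∀ {n} (C : Family n) (u v : Fin n) →
                      Σ (Subset n) (λ β → β ∈C C × u ∉ β × v ∉ β) ⊎ (∀ β → β ∈C C → u ∈ β ⊎ v ∈ β)
avoiding-or-meeting C u v with anySubset? (λ β → (C β Boolₚ.≟ true) ×-dec ¬? (u ∈? β) ×-dec ¬? (v ∈? β))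
... | yes avoiding = inj₁ avoiding
... | no ∄avoiding = inj₂ meets
  where
  meets : ∀ β → β ∈C C → u ∈ β ⊎ v ∈ β
  meets β β∈C with u ∈? β | v ∈? β
  ... | yes u∈β | _       = inj₁ u∈β
  ... | no _    | yes v∈β = inj₂ v∈β
  ... | no u∉β  | no v∉β  = contradiction (β , β∈C , u∉β , v∉β) ∄avoiding

double-counting-bound : ∀ n k N r → n * r ≡ N * k → N ≤ 2 * r → 1 ≤ N → n ≤ 2 * k
double-counting-bound n k N zero      _       N≤0  1≤N = ⊥-elim (<⇒≱ 1≤N N≤0)
double-counting-bound n k N r@(suc _) n*r≡N*k N≤2r _   = *-cancelʳ-≤ n (2 * k) r (begin
  n * r          ≡⟨ n*r≡N*k ⟩
  N * k          ≤⟨ *-monoˡ-≤ k N≤2r ⟩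
  2 * r * k      ≡⟨ *-assoc 2 r k ⟩
  2 * (r * k)    ≡⟨ cong (2 *_) (*-comm r k) ⟩
  2 * (k * r)    ≡⟨ *-assoc 2 k r ⟨
  2 * k * r      ∎)
  where open ≤-Reasoning

lemma6p4 : (n k : ℕ) → 2 ≤ k → 2 * k + 1 ≤ n → (C : Family n) → IsCode n k C
    → AutTransitive C → (u v : Fin n)
    → Σ (Subset n) (λ β → β ∈C C × u ∉ β × v ∉ β)
lemma6p4 n k _ 2k+1≤n C (uniform , β₀ , _ , β₀∈C , _) transitive u v with avoiding-or-meeting C u v
... | inj₁ avoiding = avoiding
... | inj₂ meets    = contradiction (≤-trans 2k+1≤n n≤2k) (m+1+n≰m (2 * k))
  where
  r : ℕ
  r = degree C u

  cardinality≤2*r : cardinality C ≤ 2 * r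
  cardinality≤2*r = begin
    cardinality C   ≤⟨ cardinality≤degree+degree C meets ⟩
    r + degree C v  ≡⟨ cong (r +_) (degree-constant C transitive v u) ⟩
    r + r           ≡⟨ cong (r +_) (+-identityʳ r) ⟨
    2 * r           ∎
    where open ≤-Reasoning

  n≤2k : n ≤ 2 * k
  n≤2k = double-counting-bound n k (cardinality C) r (n*degree≡cardinality*k C uniform transitive u)
                               cardinality≤2*r (cardinality-pos C β₀∈C)
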